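{- Let $b\ge1$, let $n\ge 1$, let $\mathcal{C}=\{C_1,\dots,C_b\}$, and let $\sigma$ be a permutation of $\{1,\dots,b\}$. Then the number $JS(\sigma,n,\mathcal{C})$ of juggling card sequences $A$ of length $n$ with all cards from $\mathcal{C}$ and with $\pi_A=\sigma$ equals \[ JS(\sigma,n,\mathcal{C})=\sum_{k=b-L(\sigma)}^{b}\left\{ {n \atop k} \right\}, \] where $\left\{ {n \atop k} \right\}$ denotes the Stirling number of the second kind (number of partitions of $\{1,\dots,n\}$ into $k$ nonempty blocks).
   Context: There are $b$ balls on levels $1,\dots,b$. For $1\le i\le b$ the card $C_i$ induces the permutation $\pi_{C_i}$ of $[b]$ with $\pi_{C_i}(1)=i$, $\pi_{C_i}(j)=j-1$ for $2\le j\le i$, and $\pi_{C_i}(j)=j$ for $i<j\le b$ (a ball at level $j$ on the left of the card ends on level $\pi_{C_i}(j)$ on the right). A juggling card sequence of length $n$ is a word $A=C_{i_1}C_{i_2}\cdots C_{i_n}$; starting with ball $j$ at level $j$ for all $j$ and passing through the cards from left to right, $\pi_A(j)$ is the final level of ball $j$, i.e. $\pi_A=\pi_{C_{i_n}}\circ\cdots\circ\pi_{C_{i_1}}$. For a permutation $\sigma$ of $[b]$, $L(\sigma)$ is the largest $\ell$ such that $\sigma(b-\ell+1)<\cdots<\sigma(b-1)<\sigma(b)$. -}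

module Defs where

open import Data.Nat using (ℕ; zero; suc; _+_; _*_; _∸_; _<_; _≤_)
open import Data.Nat.Properties using (_<?_)
open import Data.Fin using (Fin; toℕ; fromℕ<)
import Data.Fin as F
open import Data.Fin.Properties using (_≟_; all?)
open import Data.Fin.Permutation using (Permutation′; _⟨$⟩ʳ_)
open import Data.Vec using (Vec; []; _∷_; foldl)
open import Data.List using (List; []; _∷_; map; concatMap; length; filter; allFin)
open import Data.Bool using (if_then_else_)
open import Relation.Nullary using (Dec; does; yes; no)
open import Relation.Nullary.Decidable using (_×-dec_; _→-dec_)
open import Relation.Binary.PropositionalEquality using (_≡_)

-- Levels 1..b are represented by Fin b (level j ↔ toℕ j + 1).
-- A card C_i (1 ≤ i ≤ b) is represented by its index i : Fin b.

-- π_{C_i}: level 1 ↦ i, level j ↦ j-1 for 2 ≤ j ≤ i, level j ↦ j for j > i.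
-- In 0-based terms: 0 ↦ i, 0 < j ≤ i ↦ j-1, j > i ↦ j.
cardPerm : {b : ℕ} → Fin b → Fin b → Fin b
cardPerm i F.zero    = i
cardPerm i (F.suc j) = if does (toℕ (F.suc j) Data.Nat.≤? toℕ i)
                         then F.inject₁ j
                         else F.suc j

-- π_A for A = C_{i_1} ⋯ C_{i_n}:  π_A = π_{C_{i_n}} ∘ ⋯ ∘ π_{C_{i_1}}
-- (cards are applied left to right).
seqPerm : {b n : ℕ} → Vec (Fin b) n → Fin b → Fin b
seqPerm A j = foldl (λ _ → Fin _) (λ lvl i → cardPerm i lvl) j A

allWords : (b n : ℕ) → List (Vec (Fin b) n)
allWords b zero    = [] ∷ []
allWords b (suc n) = concatMap (λ i → map (i ∷_) (allWords b n)) (allFin b)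

JS : {b : ℕ} → Permutation′ b → ℕ → ℕ
JS {b} σ n =
  length (filter (λ A → all? (λ j → seqPerm A j ≟ (σ ⟨$⟩ʳ j))) (allWords b n))

-- σ on 0-based natural-number positions (value irrelevant out of range).
σℕ : {b : ℕ} → Permutation′ b → ℕ → ℕ
σℕ {b} σ m with m <? b
... | yes m<b = toℕ (σ ⟨$⟩ʳ fromℕ< m<b)
... | no _    = 0

-- IncTail σ ℓ : σ(b-ℓ+1) < ⋯ < σ(b)  (1-based), i.e. for every 1-based
-- position p with b-ℓ+1 ≤ p < b we have σ(p) < σ(p+1).
-- 0-based: for every m < b with b ∸ ℓ ≤ m and m + 1 < b, σ m < σ (m+1).
IncTail : {b : ℕ} → Permutation′ b → ℕ → Set
IncTail {b} σ ℓ = (m : Fin b) → b ∸ ℓ ≤ toℕ m → suc (toℕ m) < b →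
                  σℕ σ (toℕ m) < σℕ σ (suc (toℕ m))

IncTail? : {b : ℕ} (σ : Permutation′ b) (ℓ : ℕ) → Dec (IncTail σ ℓ)
IncTail? {b} σ ℓ = all? (λ m → (b ∸ ℓ Data.Nat.≤? toℕ m) →-dec
                               ((suc (toℕ m) <? b) →-dec
                                (σℕ σ (toℕ m) <? σℕ σ (suc (toℕ m)))))

largestInc : {b : ℕ} → Permutation′ b → ℕ → ℕ
largestInc σ zero    = zero
largestInc σ (suc k) with IncTail? σ (suc k)
... | yes _ = suc k
... | no  _ = largestInc σ k

-- L(σ): the largest ℓ (0 ≤ ℓ ≤ b) such that σ(b-ℓ+1) < ⋯ < σ(b).
L : {b : ℕ} → Permutation′ b → ℕ
L {b} σ = largestInc σ b

S₂ : ℕ → ℕ → ℕ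
S₂ zero    zero    = 1
S₂ zero    (suc k) = 0
S₂ (suc n) zero    = 0
S₂ (suc n) (suc k) = suc k * S₂ n (suc k) + S₂ n k

-- Σ_{k=lo}^{hi} f k  (empty if hi < lo).
sumFromTo : ℕ → ℕ → (ℕ → ℕ) → ℕ
sumFromTo lo hi f = go (suc hi ∸ lo)
  where
  go : ℕ → ℕ
  go zero    = 0
  go (suc c) = f (lo + c) + go c

module Submission where

-- Write c(σ) = b - L(σ), the (0-based) start of the maximal increasing tail
-- of σ, and T(n, c) = Σ_{j=c}^{b} S(n, j).  We show JS(σ, n) = T(n, c(σ))
-- for every n ≥ 0, by induction on n.
-- * Base: the empty word realises only the identity, whose tail starts at 0.
-- * Step: classifying words by their last card C_i gives
--   JS(σ, n+1) = Σ_i JS(C_i⁻¹ ∘ σ, n).  Reindexing by i = σ(q), the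
--   permutation C_{σ(q)}⁻¹ ∘ σ is σ with position q lowered to the bottom
--   level, so its tail starts at c(σ) if q + 1 < c(σ) and at q otherwise.
--   Hence JS(σ, n+1) = (c-1) T(n, c) + Σ_{p=c-1}^{b-1} T(n, p), and this is
--   T(n+1, c) by the recurrence S(n+1, j) = j S(n, j) + S(n, j-1).

open import Defs
open import Data.Nat using (ℕ; zero; suc; pred; _+_; _*_; _∸_; _<_; _≤_; z≤n; s≤s)
open import Data.Nat.Properties as ℕP using (_<?_)
open import Data.Nat.ListAction using () renaming (sum to listSum)
open import Data.Nat.Tactic.RingSolver using (solve-∀)
open import Data.Nat.ListAction.Properties using () renaming (sum-++ to listSum-++)
open import Data.Fin using (Fin; toℕ; fromℕ<; punchIn; punchOut)
import Data.Fin as F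
open import Data.Fin.Properties as FinP using (_≟_; all?)
open import Data.Fin.Permutation using (Permutation′; permutation; _⟨$⟩ʳ_; _⟨$⟩ˡ_; _∘ₚ_; inverseˡ)
open import Data.Vec using (Vec; []; _∷_; _∷ʳ_)
open import Data.Vec.Properties using (foldl-∷ʳ)
open import Data.List using (List; []; _∷_; _++_; map; concatMap; length; filter; allFin; tabulate)
open import Data.List.Properties using (map-++; map-∘; map-cong; map-tabulate)
open import Data.Bool using (if_then_else_; true; false)
open import Data.Empty using (⊥-elim)
open import Data.Sum using (inj₁; inj₂)
open import Function using (_∘_)
open import Relation.Nullary using (Dec; does; yes; no; ¬_)
open import Relation.Unary using (Decidable)
open import Relation.Binary.PropositionalEquality
import Algebra.Properties.CommutativeMonoid.Sum as CommutativeMonoidSum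
open CommutativeMonoidSum ℕP.+-0-commutativeMonoid
  using (sum-syntax; sum-cong-≗; ∑-comm; ∑-permute)

cardPerm-suc : ∀ {k} (i : Fin (suc k)) (j : Fin k) → cardPerm i (F.suc j) ≡ punchIn i j
cardPerm-suc F.zero    j         = refl
cardPerm-suc (F.suc i) F.zero    = refl
cardPerm-suc (F.suc i) (F.suc j) with cardPerm-suc i j
... | eq with does (suc (toℕ j) ℕP.≤? toℕ i)
...   | true  = cong F.suc eq
...   | false = cong F.suc eq

cardInv : ∀ {k} → Fin (suc k) → Fin (suc k) → Fin (suc k)
cardInv i v with i ≟ v
... | yes _  = F.zero
... | no i≢v = F.suc (punchOut i≢v)

cardPerm-cardInv : ∀ {k} (i v : Fin (suc k)) → cardPerm i (cardInv i v) ≡ v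
cardPerm-cardInv i v with i ≟ v
... | yes i≡v = i≡v
... | no i≢v  = trans (cardPerm-suc i (punchOut i≢v)) (FinP.punchIn-punchOut i≢v)

cardInv-cardPerm : ∀ {k} (i u : Fin (suc k)) → cardInv i (cardPerm i u) ≡ u
cardInv-cardPerm i F.zero with i ≟ i
... | yes _  = refl
... | no i≢i = ⊥-elim (i≢i refl)
cardInv-cardPerm i (F.suc j) rewrite cardPerm-suc i j with i ≟ punchIn i j
... | yes i≡ = ⊥-elim (FinP.punchInᵢ≢i i j (sym i≡))
... | no i≢  = cong F.suc (trans (FinP.punchOut-cong i refl) (FinP.punchOut-punchIn i))

-- C_i as a permutation; its forward direction (⟨$⟩ʳ) is the inverse
-- map, so that σ ∘ₚ card i sends j to C_i⁻¹(σ j).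
card : ∀ {k} → Fin (suc k) → Permutation′ (suc k)
card i = permutation (cardInv i) (cardPerm i) (cardInv-cardPerm i) (cardPerm-cardInv i)

cardInv-self : ∀ {k} (i : Fin (suc k)) → toℕ (cardInv i i) ≡ 0
cardInv-self i with i ≟ i
... | yes _  = refl
... | no i≢i = ⊥-elim (i≢i refl)

cardInv-positive : ∀ {k} (i v : Fin (suc k)) → i ≢ v → 0 < toℕ (cardInv i v)
cardInv-positive i v i≢v with i ≟ v
... | yes i≡v = ⊥-elim (i≢v i≡v)
... | no _    = s≤s z≤n

cardInv-mono-< : ∀ {k} (i u v : Fin (suc k)) → i ≢ u → i ≢ v →
                 toℕ u < toℕ v → toℕ (cardInv i u) < toℕ (cardInv i v)
cardInv-mono-< i u v i≢u i≢v u<v with i ≟ u | i ≟ v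
... | yes i≡u | _       = ⊥-elim (i≢u i≡u)
... | no _    | yes i≡v = ⊥-elim (i≢v i≡v)
... | no i≢u′ | no i≢v′ =
  s≤s (ℕP.≰⇒> (λ v≤u → ℕP.<⇒≱ u<v (FinP.punchOut-cancel-≤ i≢v′ i≢u′ v≤u)))

cardInv-cancel-< : ∀ {k} (i u v : Fin (suc k)) → i ≢ u → i ≢ v →
                   toℕ (cardInv i u) < toℕ (cardInv i v) → toℕ u < toℕ v
cardInv-cancel-< i u v i≢u i≢v lt with i ≟ u | i ≟ v
... | yes i≡u | _       = ⊥-elim (i≢u i≡u)
... | no _    | yes i≡v = ⊥-elim (i≢v i≡v)
... | no i≢u′ | no i≢v′ =
  ℕP.≰⇒> (λ v≤u → ℕP.<⇒≱ (ℕP.≤-pred lt) (FinP.punchOut-mono-≤ i≢v′ i≢u′ v≤u))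

indicator : {P : Set} → Dec P → ℕ
indicator d = if does d then 1 else 0

indicator-cong : {P Q : Set} (p : Dec P) (q : Dec Q) → (P → Q) → (Q → P) →
                 indicator p ≡ indicator q
indicator-cong (yes _) (yes _) _   _   = refl
indicator-cong (yes p) (no ¬q) p→q _   = ⊥-elim (¬q (p→q p))
indicator-cong (no ¬p) (yes q) _   q→p = ⊥-elim (¬p (q→p q))
indicator-cong (no _)  (no _)  _   _   = refl

indicator-yes : {P : Set} (p : Dec P) → P → indicator p ≡ 1
indicator-yes (yes _) _  = refl
indicator-yes (no ¬p) p = ⊥-elim (¬p p)

indicator-no : {P : Set} (p : Dec P) → ¬ P → indicator p ≡ 0
indicator-no (yes p) ¬p = ⊥-elim (¬p p)
indicator-no (no _)  _  = refl

length-filter : {A : Set} {P : A → Set} (P? : Decidable P) (xs : List A) →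
                length (filter P? xs) ≡ listSum (map (indicator ∘ P?) xs)
length-filter P? []       = refl
length-filter P? (x ∷ xs) with does (P? x)
... | true  = cong suc (length-filter P? xs)
... | false = length-filter P? xs

listSum-concatMap : {A B : Set} (f : B → ℕ) (h : A → List B) (xs : List A) →
  listSum (map f (concatMap h xs)) ≡ listSum (map (λ x → listSum (map f (h x))) xs)
listSum-concatMap f h []       = refl
listSum-concatMap f h (x ∷ xs) = begin
  listSum (map f (h x ++ concatMap h xs))
    ≡⟨ cong listSum (map-++ f (h x) (concatMap h xs)) ⟩
  listSum (map f (h x) ++ map f (concatMap h xs))
    ≡⟨ listSum-++ (map f (h x)) _ ⟩
  listSum (map f (h x)) + listSum (map f (concatMap h xs))
    ≡⟨ cong (listSum (map f (h x)) +_) (listSum-concatMap f h xs) ⟩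
  listSum (map f (h x)) + listSum (map (λ x → listSum (map f (h x))) xs) ∎
  where open ≡-Reasoning

listSum-tabulate : ∀ {b} (g : Fin b → ℕ) → listSum (tabulate g) ≡ ∑[ i < b ] g i
listSum-tabulate {zero}  g = refl
listSum-tabulate {suc b} g = cong (g F.zero +_) (listSum-tabulate (g ∘ F.suc))

listSum-allFin : ∀ {b} (g : Fin b → ℕ) → listSum (map g (allFin b)) ≡ ∑[ i < b ] g i
listSum-allFin {b} g = trans (cong listSum (map-tabulate (λ i → i) g)) (listSum-tabulate g)

wordSum : (b n : ℕ) → (Vec (Fin b) n → ℕ) → ℕ
wordSum b n f = listSum (map f (allWords b n))

wordSum-cong : ∀ {b} n {f g : Vec (Fin b) n → ℕ} → (∀ A → f A ≡ g A) →
               wordSum b n f ≡ wordSum b n g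
wordSum-cong {b} n f≗g = cong listSum (map-cong f≗g (allWords b n))

wordSum-cons : ∀ {b} n (f : Vec (Fin b) (suc n) → ℕ) →
               wordSum b (suc n) f ≡ ∑[ i < b ] wordSum b n (λ A → f (i ∷ A))
wordSum-cons {b} n f = begin
  listSum (map f (concatMap (λ i → map (i ∷_) (allWords b n)) (allFin b)))
    ≡⟨ listSum-concatMap f (λ i → map (i ∷_) (allWords b n)) (allFin b) ⟩
  listSum (map (λ i → listSum (map f (map (i ∷_) (allWords b n)))) (allFin b))
    ≡⟨ cong listSum (map-cong (λ i → cong listSum (sym (map-∘ (allWords b n)))) (allFin b)) ⟩
  listSum (map (λ i → wordSum b n (λ A → f (i ∷ A))) (allFin b))
    ≡⟨ listSum-allFin (λ i → wordSum b n (λ A → f (i ∷ A))) ⟩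
  ∑[ i < b ] wordSum b n (λ A → f (i ∷ A)) ∎
  where open ≡-Reasoning

wordSum-snoc : ∀ {b} n (f : Vec (Fin b) (suc n) → ℕ) →
               wordSum b (suc n) f ≡ ∑[ i < b ] wordSum b n (λ A → f (A ∷ʳ i))
wordSum-snoc zero    f = wordSum-cons zero f
wordSum-snoc {b} (suc n) f = begin
  wordSum b (suc (suc n)) f
    ≡⟨ wordSum-cons (suc n) f ⟩
  ∑[ i < b ] wordSum b (suc n) (λ A → f (i ∷ A))
    ≡⟨ sum-cong-≗ (λ i → wordSum-snoc n (λ A → f (i ∷ A))) ⟩
  ∑[ i < b ] ∑[ j < b ] wordSum b n (λ A → f (i ∷ (A ∷ʳ j)))
    ≡⟨ ∑-comm (λ i j → wordSum b n (λ A → f (i ∷ (A ∷ʳ j)))) ⟩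
  ∑[ j < b ] ∑[ i < b ] wordSum b n (λ A → f (i ∷ (A ∷ʳ j)))
    ≡⟨ sum-cong-≗ (λ j → sym (wordSum-cons n (λ B → f (B ∷ʳ j)))) ⟩
  ∑[ j < b ] wordSum b (suc n) (λ B → f (B ∷ʳ j)) ∎
  where open ≡-Reasoning

realises? : ∀ {b n} (σ : Permutation′ b) (A : Vec (Fin b) n) →
            Dec (∀ j → seqPerm A j ≡ σ ⟨$⟩ʳ j)
realises? σ A = all? (λ j → seqPerm A j ≟ (σ ⟨$⟩ʳ j))

JS-wordSum : ∀ {b} (σ : Permutation′ b) n →
             JS σ n ≡ wordSum b n (indicator ∘ realises? σ)
JS-wordSum {b} σ n = length-filter (realises? σ) (allWords b n)

seqPerm-∷ʳ : ∀ {b n} (A : Vec (Fin b) n) i j → seqPerm (A ∷ʳ i) j ≡ cardPerm i (seqPerm A j)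
seqPerm-∷ʳ {b} A i j = foldl-∷ʳ (λ _ → Fin b) (λ lvl i → cardPerm i lvl) j i A

-- Classifying by the last card: A C_i realises σ iff A realises
-- C_i⁻¹ ∘ σ.  Hence JS(σ, n+1) = Σ_i JS(C_i⁻¹ ∘ σ, n).
JS-lastCard : ∀ {k} (σ : Permutation′ (suc k)) n →
              JS σ (suc n) ≡ ∑[ i < suc k ] JS (σ ∘ₚ card i) n
JS-lastCard σ n = begin
  JS σ (suc n)
    ≡⟨ JS-wordSum σ (suc n) ⟩
  wordSum _ (suc n) (indicator ∘ realises? σ)
    ≡⟨ wordSum-snoc n (indicator ∘ realises? σ) ⟩
  ∑[ i < _ ] wordSum _ n (λ A → indicator (realises? σ (A ∷ʳ i)))
    ≡⟨ sum-cong-≗ (λ i → wordSum-cong n (λ A →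
         indicator-cong (realises? σ (A ∷ʳ i)) (realises? (σ ∘ₚ card i) A)
           (to i A) (from i A))) ⟩
  ∑[ i < _ ] wordSum _ n (indicator ∘ realises? (σ ∘ₚ card i))
    ≡⟨ sum-cong-≗ (λ i → sym (JS-wordSum (σ ∘ₚ card i) n)) ⟩
  ∑[ i < _ ] JS (σ ∘ₚ card i) n ∎
  where
  open ≡-Reasoning
  to : ∀ i A → (∀ j → seqPerm (A ∷ʳ i) j ≡ σ ⟨$⟩ʳ j) →
       ∀ j → seqPerm A j ≡ cardInv i (σ ⟨$⟩ʳ j)
  to i A realised j = begin
    seqPerm A j                          ≡⟨ cardInv-cardPerm i (seqPerm A j) ⟨
    cardInv i (cardPerm i (seqPerm A j)) ≡⟨ cong (cardInv i) (seqPerm-∷ʳ A i j) ⟨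
    cardInv i (seqPerm (A ∷ʳ i) j)       ≡⟨ cong (cardInv i) (realised j) ⟩
    cardInv i (σ ⟨$⟩ʳ j)                 ∎
  from : ∀ i A → (∀ j → seqPerm A j ≡ cardInv i (σ ⟨$⟩ʳ j)) →
         ∀ j → seqPerm (A ∷ʳ i) j ≡ σ ⟨$⟩ʳ j
  from i A realised j = begin
    seqPerm (A ∷ʳ i) j                ≡⟨ seqPerm-∷ʳ A i j ⟩
    cardPerm i (seqPerm A j)          ≡⟨ cong (cardPerm i) (realised j) ⟩
    cardPerm i (cardInv i (σ ⟨$⟩ʳ j)) ≡⟨ cardPerm-cardInv i (σ ⟨$⟩ʳ j) ⟩
    σ ⟨$⟩ʳ j                          ∎

-- s is increasing on the positions c, c+1, …, b-1.  Positions range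
-- over Fin b, so that IncTail σ ℓ is literally
-- IncreasingFrom b (σℕ σ) (b ∸ ℓ).
IncreasingFrom : ℕ → (ℕ → ℕ) → ℕ → Set
IncreasingFrom b s c =
  (m : Fin b) → c ≤ toℕ m → suc (toℕ m) < b → s (toℕ m) < s (suc (toℕ m))

increasingAt : ∀ {b s c} → IncreasingFrom b s c →
               ∀ m → c ≤ m → suc m < b → s m < s (suc m)
increasingAt {b} {s} {c} inc m c≤m 1+m<b =
  subst (λ x → c ≤ x → suc x < b → s x < s (suc x)) (FinP.toℕ-fromℕ< m<b)
        (inc (fromℕ< m<b)) c≤m 1+m<b
  where
  m<b : m < b
  m<b = ℕP.<-trans (ℕP.n<1+n m) 1+m<b

-- One more ascent at the front extends an increasing tail by one position
-- (the ascent is only needed when suc d is still a position).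
increasing-extend : ∀ {b s d} → IncreasingFrom b s (suc d) →
                    (suc d < b → s d < s (suc d)) → IncreasingFrom b s d
increasing-extend inc ascent m d≤m 1+m<b with ℕP.m≤n⇒m<n∨m≡n d≤m
... | inj₁ d<m  = inc m d<m 1+m<b
... | inj₂ refl = ascent 1+m<b

record TailStart (b : ℕ) (s : ℕ → ℕ) (c : ℕ) : Set where
  field
    start<b        : c < b
    increasing     : IncreasingFrom b s c
    noAscentBefore : ∀ d → suc d ≡ c → ¬ (s d < s c)
open TailStart

-- The maximal increasing tail is unique: a later start c′ > c would
-- sit inside the increasing tail from c and so be preceded by an ascent.
tailStart-unique : ∀ {b s c c′} → TailStart b s c → TailStart b s c′ → c ≡ c′
tailStart-unique tc tc′ =
  ℕP.≤-antisym (ℕP.≮⇒≥ (notBefore tc′ tc)) (ℕP.≮⇒≥ (notBefore tc tc′))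
  where
  notBefore : ∀ {b s c c′} → TailStart b s c → TailStart b s c′ → ¬ (c < c′)
  notBefore {c′ = suc d} tc tc′ (s≤s c≤d) =
    noAscentBefore tc′ d refl (increasingAt (increasing tc) d c≤d (start<b tc′))

record LargestTail {b} (σ : Permutation′ b) (k r : ℕ) : Set where
  field
    r≤k     : r ≤ k
    holds   : IncTail σ r
    maximal : ∀ m → r < m → m ≤ k → ¬ IncTail σ m

incTail-0 : ∀ {b} (σ : Permutation′ b) → IncTail σ 0
incTail-0 σ m b≤m _ = ⊥-elim (ℕP.<⇒≱ (FinP.toℕ<n m) b≤m)

largestInc-spec : ∀ {b} (σ : Permutation′ b) k → LargestTail σ k (largestInc σ k)
largestInc-spec σ zero = record
  { r≤k = z≤n ; holds = incTail-0 σ ; maximal = λ m 0<m m≤0 _ → ℕP.<⇒≱ 0<m m≤0 }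
largestInc-spec σ (suc k) with IncTail? σ (suc k)
... | yes holds = record
  { r≤k = ℕP.≤-refl ; holds = holds ; maximal = λ m k<m m≤k _ → ℕP.<⇒≱ k<m m≤k }
... | no fails = record
  { r≤k     = ℕP.m≤n⇒m≤1+n (LargestTail.r≤k spec)
  ; holds   = LargestTail.holds spec
  ; maximal = maximal }
  where
  spec = largestInc-spec σ k
  maximal : ∀ m → largestInc σ k < m → m ≤ suc k → ¬ IncTail σ m
  maximal m r<m m≤1+k with ℕP.m≤n⇒m<n∨m≡n m≤1+k
  ... | inj₁ m<1+k = LargestTail.maximal spec m r<m (ℕP.≤-pred m<1+k)
  ... | inj₂ refl  = fails

start : ∀ {b} → Permutation′ b → ℕ
start {b} σ = b ∸ L σ

tailStart-start : ∀ {b} (σ : Permutation′ b) → 1 ≤ b → TailStart b (σℕ σ) (start σ)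
tailStart-start {b} σ 1≤b = record
  { start<b        = ℕP.∸-monoʳ-< 0<L L≤b
  ; increasing     = holds
  ; noAscentBefore = noAscentBefore′ }
  where
  open LargestTail (largestInc-spec σ b) renaming (r≤k to L≤b)
  -- a tail of length 1 is always increasing, so L σ ≥ 1
  incTail-1 : IncTail σ 1
  incTail-1 m b∸1≤m 1+m<b =
    ⊥-elim (ℕP.<⇒≱ 1+m<b (ℕP.≤-trans (ℕP.m≤n+m∸n b 1) (s≤s b∸1≤m)))
  0<L : 0 < L σ
  0<L = ℕP.≰⇒> (λ L≤0 → maximal 1 (s≤s L≤0) 1≤b incTail-1)
  -- an ascent just before the tail would make a longer tail increasing
  noAscentBefore′ : ∀ d → suc d ≡ start σ → ¬ (σℕ σ d < σℕ σ (start σ))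
  noAscentBefore′ d 1+d≡c ascent =
    maximal (suc (L σ)) (ℕP.n<1+n (L σ)) L<b
      (subst (IncreasingFrom b (σℕ σ)) (sym b∸[1+L]≡d)
        (increasing-extend (subst (IncreasingFrom b (σℕ σ)) (sym 1+d≡c) holds)
          (λ _ → subst (λ x → σℕ σ d < σℕ σ x) (sym 1+d≡c) ascent)))
    where
    L<b : L σ < b
    L<b = ℕP.m∸n≢0⇒n<m (λ c≡0 → ℕP.1+n≢0 (trans 1+d≡c c≡0))
    b∸[1+L]≡d : b ∸ suc (L σ) ≡ d
    b∸[1+L]≡d = trans (sym (ℕP.pred[m∸n]≡m∸[1+n] b (L σ))) (cong pred (sym 1+d≡c))

start-unique : ∀ {b} (σ : Permutation′ b) {c} → TailStart b (σℕ σ) c → start σ ≡ c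
start-unique σ tc = tailStart-unique (tailStart-start σ (ℕP.≤-trans (s≤s z≤n) (start<b tc))) tc

record LowersAt (b p : ℕ) (s t : ℕ → ℕ) : Set where
  field
    p<b       : p < b
    lowered   : t p ≡ 0
    raised    : ∀ m → m < b → m ≢ p → 0 < t m
    preserves : ∀ m m′ → m < b → m′ < b → m ≢ p → m′ ≢ p → s m < s m′ → t m < t m′
    reflects  : ∀ m m′ → m < b → m′ < b → m ≢ p → m′ ≢ p → t m < t m′ → s m < s m′
open LowersAt

-- Lowering a position p < c - 1 leaves the tail [c, b) and the descent
-- into it untouched, so the tail still starts at c.
tailStart-lower-early : ∀ {b p s t c} → LowersAt b p s t → TailStart b s c →
                        suc p < c → TailStart b t c
tailStart-lower-early {b} {p} {s} {t} {c} low tc 1+p<c = record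
  { start<b        = start<b tc
  ; increasing     = increasing′
  ; noAscentBefore = noAscentBefore′ }
  where
  p<c : p < c
  p<c = ℕP.<-trans (ℕP.n<1+n p) 1+p<c
  increasing′ : IncreasingFrom b t c
  increasing′ m c≤m 1+m<b =
    preserves low (toℕ m) (suc (toℕ m)) (FinP.toℕ<n m) 1+m<b
      (ℕP.>⇒≢ (ℕP.<-≤-trans p<c c≤m))
      (ℕP.>⇒≢ (ℕP.<-trans (ℕP.<-≤-trans p<c c≤m) (ℕP.n<1+n (toℕ m))))
      (increasing tc m c≤m 1+m<b)
  noAscentBefore′ : ∀ d → suc d ≡ c → ¬ (t d < t c)
  noAscentBefore′ d refl ascent =
    noAscentBefore tc d refl
      (reflects low d c (ℕP.<-trans (ℕP.n<1+n d) (start<b tc)) (start<b tc)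
        (ℕP.>⇒≢ (ℕP.≤-pred 1+p<c)) (ℕP.>⇒≢ p<c) ascent)

-- Lowering a position p ≥ c - 1 makes p the new start: t p = 0 lies
-- below all later values, which keep their (increasing) order.
tailStart-lower-late : ∀ {b p s t c} → LowersAt b p s t → TailStart b s c →
                       c ≤ suc p → TailStart b t p
tailStart-lower-late {b} {p} {s} {t} {c} low tc c≤1+p = record
  { start<b        = p<b low
  ; increasing     = increasing-extend increasingAfter ascentAt
  ; noAscentBefore = λ d _ ascent → ℕP.n≮0 (subst (t d <_) (lowered low) ascent) }
  where
  increasingAfter : IncreasingFrom b t (suc p)
  increasingAfter m 1+p≤m 1+m<b =
    preserves low (toℕ m) (suc (toℕ m)) (FinP.toℕ<n m) 1+m<b
      (ℕP.>⇒≢ 1+p≤m) (ℕP.>⇒≢ (ℕP.<-trans 1+p≤m (ℕP.n<1+n (toℕ m))))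
      (increasing tc m (ℕP.≤-trans c≤1+p 1+p≤m) 1+m<b)
  ascentAt : suc p < b → t p < t (suc p)
  ascentAt 1+p<b =
    subst (_< t (suc p)) (sym (lowered low)) (raised low (suc p) 1+p<b (ℕP.>⇒≢ (ℕP.n<1+n p)))

newStart : ℕ → ℕ → ℕ
newStart c p with suc p <? c
... | yes _ = c
... | no  _ = p

tailStart-lower : ∀ {b p s t c} → LowersAt b p s t → TailStart b s c →
                  TailStart b t (newStart c p)
tailStart-lower {p = p} {c = c} low tc with suc p <? c
... | yes 1+p<c = tailStart-lower-early low tc 1+p<c
... | no  1+p≮c = tailStart-lower-late low tc (ℕP.≮⇒≥ 1+p≮c)

σℕ-inRange : ∀ {b} (σ : Permutation′ b) m (m<b : m < b) → σℕ σ m ≡ toℕ (σ ⟨$⟩ʳ fromℕ< m<b)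
σℕ-inRange {b} σ m m<b with m <? b
... | yes _   = refl
... | no  m≮b = ⊥-elim (m≮b m<b)

σℕ-toℕ : ∀ {b} (σ : Permutation′ b) (j : Fin b) → σℕ σ (toℕ j) ≡ toℕ (σ ⟨$⟩ʳ j)
σℕ-toℕ σ j = trans (σℕ-inRange σ (toℕ j) (FinP.toℕ<n j))
                   (cong (λ i → toℕ (σ ⟨$⟩ʳ i)) (FinP.fromℕ<-toℕ j (FinP.toℕ<n j)))

-- Appending the card C_i with i = σ(q) lowers position q of σ to the
-- bottom level: C_i⁻¹ ∘ σ sends q to 0 and keeps the order of the rest.
lowersAt-card : ∀ {k} (σ : Permutation′ (suc k)) (q : Fin (suc k)) →
                LowersAt (suc k) (toℕ q) (σℕ σ) (σℕ (σ ∘ₚ card (σ ⟨$⟩ʳ q)))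
lowersAt-card {k} σ q = record
  { p<b       = FinP.toℕ<n q
  ; lowered   = lowered′
  ; raised    = λ m m<b m≢q → subst (0 <_) (sym (τ-inRange m m<b))
                  (cardInv-positive i _ (i≢ m m<b m≢q))
  ; preserves = λ m m′ m<b m′<b m≢q m′≢q lt →
                  subst₂ _<_ (sym (τ-inRange m m<b)) (sym (τ-inRange m′ m′<b))
                    (cardInv-mono-< i _ _ (i≢ m m<b m≢q) (i≢ m′ m′<b m′≢q)
                      (subst₂ _<_ (σℕ-inRange σ m m<b) (σℕ-inRange σ m′ m′<b) lt))
  ; reflects  = λ m m′ m<b m′<b m≢q m′≢q lt →
                  subst₂ _<_ (sym (σℕ-inRange σ m m<b)) (sym (σℕ-inRange σ m′ m′<b))
                    (cardInv-cancel-< i _ _ (i≢ m m<b m≢q) (i≢ m′ m′<b m′≢q)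
                      (subst₂ _<_ (τ-inRange m m<b) (τ-inRange m′ m′<b) lt)) }
  where
  i = σ ⟨$⟩ʳ q
  τ = σ ∘ₚ card i
  τ-inRange : ∀ m (m<b : m < suc k) → σℕ τ m ≡ toℕ (cardInv i (σ ⟨$⟩ʳ fromℕ< m<b))
  τ-inRange = σℕ-inRange τ
  lowered′ : σℕ τ (toℕ q) ≡ 0
  lowered′ = trans (σℕ-toℕ τ q) (cardInv-self i)
  -- σ is injective, so only position q is sent to i
  i≢ : ∀ m (m<b : m < suc k) → m ≢ toℕ q → i ≢ σ ⟨$⟩ʳ fromℕ< m<b
  i≢ m m<b m≢q σq≡σm = m≢q (begin
    m                                ≡⟨ FinP.toℕ-fromℕ< m<b ⟨
    toℕ (fromℕ< m<b)                 ≡⟨ cong toℕ (inverseˡ σ) ⟨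
    toℕ (σ ⟨$⟩ˡ (σ ⟨$⟩ʳ fromℕ< m<b)) ≡⟨ cong (λ j → toℕ (σ ⟨$⟩ˡ j)) σq≡σm ⟨
    toℕ (σ ⟨$⟩ˡ (σ ⟨$⟩ʳ q))          ≡⟨ cong toℕ (inverseˡ σ) ⟩
    toℕ q                            ∎)
    where open ≡-Reasoning

start-afterCard : ∀ {k} (σ : Permutation′ (suc k)) (q : Fin (suc k)) →
                  start (σ ∘ₚ card (σ ⟨$⟩ʳ q)) ≡ newStart (start σ) (toℕ q)
start-afterCard σ q =
  start-unique (σ ∘ₚ card (σ ⟨$⟩ʳ q))
    (tailStart-lower (lowersAt-card σ q) (tailStart-start σ (s≤s z≤n)))

sumRange : (ℕ → ℕ) → ℕ → ℕ → ℕ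
sumRange g a zero    = 0
sumRange g a (suc e) = g a + sumRange g (suc a) e

sumRange-snoc : ∀ g a e → sumRange g a (suc e) ≡ sumRange g a e + g (a + e)
sumRange-snoc g a zero    = trans (ℕP.+-identityʳ (g a)) (cong g (sym (ℕP.+-identityʳ a)))
sumRange-snoc g a (suc e) = begin
  g a + sumRange g (suc a) (suc e)        ≡⟨ cong (g a +_) (sumRange-snoc g (suc a) e) ⟩
  g a + (sumRange g (suc a) e + g (suc a + e)) ≡⟨ ℕP.+-assoc (g a) _ _ ⟨
  sumRange g a (suc e) + g (suc a + e)    ≡⟨ cong (λ x → sumRange g a (suc e) + g x) (ℕP.+-suc a e) ⟨
  sumRange g a (suc e) + g (a + suc e)    ∎
  where open ≡-Reasoning

-- sumFromTo, the sum Σ_{k=lo}^{hi} in the statement, is an interval sum.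
-- Its auxiliary counter is reached by abstracting suc hi ∸ lo.
sumFromTo-empty : ∀ lo hi f → hi < lo → sumFromTo lo hi f ≡ 0
sumFromTo-empty lo hi f hi<lo with suc hi ∸ lo | ℕP.m≤n⇒m∸n≡0 hi<lo
... | _ | refl = refl

sumFromTo-extend : ∀ lo hi f → lo ≤ suc hi →
                   sumFromTo lo (suc hi) f ≡ f (suc hi) + sumFromTo lo hi f
sumFromTo-extend lo hi f lo≤1+hi with suc (suc hi) ∸ lo | ℕP.+-∸-assoc 1 lo≤1+hi
... | _ | refl = cong (λ x → f x + sumFromTo lo hi f) (ℕP.m+[n∸m]≡n lo≤1+hi)

sumFromTo-sumRange : ∀ lo hi f → sumFromTo lo hi f ≡ sumRange f lo (suc hi ∸ lo)
sumFromTo-sumRange lo hi f with hi <? lo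
... | yes hi<lo = trans (sumFromTo-empty lo hi f hi<lo)
                        (cong (sumRange f lo) (sym (ℕP.m≤n⇒m∸n≡0 hi<lo)))
... | no  hi≮lo = nonEmpty lo hi (ℕP.≮⇒≥ hi≮lo)
  where
  nonEmpty : ∀ lo hi → lo ≤ hi → sumFromTo lo hi f ≡ sumRange f lo (suc hi ∸ lo)
  nonEmpty .0 zero    z≤n      = refl
  nonEmpty lo (suc h) lo≤1+h = begin
    sumFromTo lo (suc h) f                        ≡⟨ sumFromTo-extend lo h f lo≤1+h ⟩
    f (suc h) + sumFromTo lo h f                  ≡⟨ cong (f (suc h) +_) (sumFromTo-sumRange lo h f) ⟩
    f (suc h) + sumRange f lo (suc h ∸ lo)        ≡⟨ ℕP.+-comm (f (suc h)) _ ⟩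
    sumRange f lo (suc h ∸ lo) + f (suc h)        ≡⟨ cong (λ x → sumRange f lo (suc h ∸ lo) + f x)
                                                       (ℕP.m+[n∸m]≡n lo≤1+h) ⟨
    sumRange f lo (suc h ∸ lo) + f (lo + (suc h ∸ lo)) ≡⟨ sumRange-snoc f lo (suc h ∸ lo) ⟨
    sumRange f lo (suc (suc h ∸ lo))              ≡⟨ cong (sumRange f lo) (ℕP.+-∸-assoc 1 lo≤1+h) ⟨
    sumRange f lo (suc (suc h) ∸ lo)              ∎
    where open ≡-Reasoning

sumRange-split : ∀ g a x y → sumRange g a (x + y) ≡ sumRange g a x + sumRange g (a + x) y
sumRange-split g a zero    y = cong (λ z → sumRange g z y) (sym (ℕP.+-identityʳ a))
sumRange-split g a (suc x) y = begin
  g a + sumRange g (suc a) (x + y)                        ≡⟨ cong (g a +_) (sumRange-split g (suc a) x y) ⟩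
  g a + (sumRange g (suc a) x + sumRange g (suc a + x) y) ≡⟨ ℕP.+-assoc (g a) _ _ ⟨
  sumRange g a (suc x) + sumRange g (suc a + x) y         ≡⟨ cong (λ z → sumRange g a (suc x) + sumRange g z y)
                                                               (ℕP.+-suc a x) ⟨
  sumRange g a (suc x) + sumRange g (a + suc x) y         ∎
  where open ≡-Reasoning

sumRange-cong : ∀ g h a e → (∀ j → j < e → g (a + j) ≡ h (a + j)) →
                sumRange g a e ≡ sumRange h a e
sumRange-cong g h a zero    _   = refl
sumRange-cong g h a (suc e) g≗h = cong₂ _+_ first (sumRange-cong g h (suc a) e rest)
  where
  first : g a ≡ h a
  first = subst (λ x → g x ≡ h x) (ℕP.+-identityʳ a) (g≗h 0 (s≤s z≤n))
  rest : ∀ j → j < e → g (suc a + j) ≡ h (suc a + j)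
  rest j j<e = subst (λ x → g x ≡ h x) (ℕP.+-suc a j) (g≗h (suc j) (s≤s j<e))

sumRange-const : ∀ g a e v → (∀ j → j < e → g (a + j) ≡ v) → sumRange g a e ≡ e * v
sumRange-const g a e v g≡v = begin
  sumRange g a e           ≡⟨ sumRange-cong g (λ _ → v) a e g≡v ⟩
  sumRange (λ _ → v) a e   ≡⟨ constant a e ⟩
  e * v                    ∎
  where
  open ≡-Reasoning
  constant : ∀ a e → sumRange (λ _ → v) a e ≡ e * v
  constant a zero    = refl
  constant a (suc e) = cong (v +_) (constant (suc a) e)

∑-sumRange : ∀ {e} g a → ∑[ q < e ] g (a + toℕ q) ≡ sumRange g a e
∑-sumRange {zero}  g a = refl
∑-sumRange {suc e} g a = cong₂ _+_ (cong g (ℕP.+-identityʳ a))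
  (trans shift (∑-sumRange {e} g (suc a)))
  where
  shift : ∑[ q < e ] g (a + suc (toℕ q)) ≡ ∑[ q < e ] g (suc a + toℕ q)
  shift = sum-cong-≗ {e} (λ q → cong g (ℕP.+-suc a (toℕ q)))

newStart-early : ∀ {c p} → suc p < c → newStart c p ≡ c
newStart-early {c} {p} 1+p<c with suc p <? c
... | yes _     = refl
... | no  1+p≮c = ⊥-elim (1+p≮c 1+p<c)

newStart-late : ∀ {c p} → c ≤ suc p → newStart c p ≡ p
newStart-late {c} {p} c≤1+p with suc p <? c
... | yes 1+p<c = ⊥-elim (ℕP.<⇒≱ 1+p<c c≤1+p)
... | no  _     = refl

-- Summing over all positions q a function of newStart c q: the c - 1
-- positions before c - 1 all give c, the others give themselves.
∑-newStart : ∀ {b} (g : ℕ → ℕ) c → c ≤ b →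
             ∑[ q < b ] g (newStart c (toℕ q)) ≡ (c ∸ 1) * g c + sumRange g (c ∸ 1) (b ∸ (c ∸ 1))
∑-newStart {b} g c c≤b = begin
  ∑[ q < b ] g (newStart c (toℕ q))
    ≡⟨ ∑-sumRange {b} (g ∘ newStart c) 0 ⟩
  sumRange (g ∘ newStart c) 0 b
    ≡⟨ cong (sumRange (g ∘ newStart c) 0) (ℕP.m+[n∸m]≡n c∸1≤b) ⟨
  sumRange (g ∘ newStart c) 0 (c ∸ 1 + (b ∸ (c ∸ 1)))
    ≡⟨ sumRange-split (g ∘ newStart c) 0 (c ∸ 1) (b ∸ (c ∸ 1)) ⟩
  sumRange (g ∘ newStart c) 0 (c ∸ 1) + sumRange (g ∘ newStart c) (c ∸ 1) (b ∸ (c ∸ 1))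
    ≡⟨ cong₂ _+_ (sumRange-const (g ∘ newStart c) 0 (c ∸ 1) (g c) early)
                 (sumRange-cong (g ∘ newStart c) g (c ∸ 1) (b ∸ (c ∸ 1)) late) ⟩
  (c ∸ 1) * g c + sumRange g (c ∸ 1) (b ∸ (c ∸ 1)) ∎
  where
  open ≡-Reasoning
  c∸1≤b : c ∸ 1 ≤ b
  c∸1≤b = ℕP.≤-trans (ℕP.m∸n≤m c 1) c≤b
  early : ∀ j → j < c ∸ 1 → g (newStart c j) ≡ g c
  early j j<c∸1 = cong g (newStart-early (below c j<c∸1))
    where
    below : ∀ c {j} → j < c ∸ 1 → suc j < c
    below (suc c) j<c = s≤s j<c
  late : ∀ j → j < b ∸ (c ∸ 1) → g (newStart c (c ∸ 1 + j)) ≡ g (c ∸ 1 + j)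
  late j _ = cong g (newStart-late (ℕP.≤-trans (ℕP.m≤n+m∸n c 1) (s≤s (ℕP.m≤m+n (c ∸ 1) j))))

tailSum : ℕ → ℕ → ℕ → ℕ
tailSum b m c = sumFromTo c b (S₂ m)

tailSum-unfold : ∀ b m c → c ≤ b → tailSum b m c ≡ S₂ m c + tailSum b m (suc c)
tailSum-unfold b m c c≤b = begin
  sumFromTo c b (S₂ m)                  ≡⟨ sumFromTo-sumRange c b (S₂ m) ⟩
  sumRange (S₂ m) c (suc b ∸ c)         ≡⟨ cong (sumRange (S₂ m) c) (ℕP.+-∸-assoc 1 c≤b) ⟩
  S₂ m c + sumRange (S₂ m) (suc c) (b ∸ c) ≡⟨ cong (S₂ m c +_) (sumFromTo-sumRange (suc c) b (S₂ m)) ⟨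
  S₂ m c + sumFromTo (suc c) b (S₂ m)   ∎
  where open ≡-Reasoning

tailSum-beyond : ∀ b m → tailSum b m (suc b) ≡ 0
tailSum-beyond b m = sumFromTo-empty (suc b) b (S₂ m) (ℕP.n<1+n b)

upperSum : ℕ → ℕ → ℕ → ℕ
upperSum b n a = sumRange (tailSum b n) a (b ∸ a)

upperSum-unfold : ∀ b n a → a < b → upperSum b n a ≡ tailSum b n a + upperSum b n (suc a)
upperSum-unfold (suc b) n a (s≤s a≤b) = cong (sumRange (tailSum (suc b) n) a) (ℕP.+-∸-assoc 1 a≤b)

upperSum-end : ∀ b n → upperSum b n b ≡ 0
upperSum-end b n = cong (sumRange (tailSum b n) b) (ℕP.n∸n≡0 b)

-- The recurrence S(n+1, j) = j S(n, j) + S(n, j-1), summed over j ≥ c: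
--   Σ_{j≥c} S(n+1, j) = (c-1) Σ_{j≥c} S(n, j) + Σ_{p=c-1}^{b-1} Σ_{j≥p} S(n, j).
tailSum-recurrence : ∀ b n c → c ≤ suc b →
                     tailSum b (suc n) c ≡ (c ∸ 1) * tailSum b n c + upperSum b n (c ∸ 1)
tailSum-recurrence b n c c≤1+b = downward (suc b ∸ c) c (ℕP.m∸n+n≡m c≤1+b)
  where
  T = tailSum b
  U = upperSum b n
  rearrange : ∀ d x y z w → (suc d * x + y) + (suc d * z + w) ≡ d * (x + z) + ((y + (x + z)) + w)
  rearrange = solve-∀
  downward : ∀ e c → e + c ≡ suc b → T (suc n) c ≡ (c ∸ 1) * T n c + U (c ∸ 1)
  downward zero .(suc b) refl = begin
    T (suc n) (suc b)       ≡⟨ tailSum-beyond b (suc n) ⟩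
    0                       ≡⟨ ℕP.*-zeroʳ b ⟨
    b * 0                   ≡⟨ ℕP.+-identityʳ (b * 0) ⟨
    b * 0 + 0               ≡⟨ cong₂ (λ x y → b * x + y) (tailSum-beyond b n) (upperSum-end b n) ⟨
    b * T n (suc b) + U b   ∎
    where open ≡-Reasoning
  downward (suc e) zero    e+1≡1+b = trans (tailSum-unfold b (suc n) 0 z≤n)
                                           (downward e 1 (trans (ℕP.+-suc e 0) e+1≡1+b))
  downward (suc e) (suc d) e+d+2≡1+b = begin
    T (suc n) (suc d)                            ≡⟨ tailSum-unfold b (suc n) (suc d) 1+d≤b ⟩
    S₂ (suc n) (suc d) + T (suc n) (suc (suc d)) ≡⟨ cong (S₂ (suc n) (suc d) +_) (downward e (suc (suc d)) e+d+2≡1+b′) ⟩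
    (suc d * x + y) + (suc d * z + w)            ≡⟨ rearrange d x y z w ⟩
    d * (x + z) + ((y + (x + z)) + w)            ≡⟨ cong (λ u → d * u + ((y + u) + w)) (tailSum-unfold b n (suc d) 1+d≤b) ⟨
    d * T n (suc d) + ((y + T n (suc d)) + w)    ≡⟨ cong (λ u → d * T n (suc d) + (u + w)) (tailSum-unfold b n d d≤b) ⟨
    d * T n (suc d) + (T n d + U (suc d))        ≡⟨ cong (d * T n (suc d) +_) (upperSum-unfold b n d 1+d≤b) ⟨
    d * T n (suc d) + U d                        ∎
    where
    open ≡-Reasoning
    x = S₂ n (suc d)
    y = S₂ n d
    z = T n (suc (suc d))
    w = U (suc d)
    e+d+2≡1+b′ : e + suc (suc d) ≡ suc b
    e+d+2≡1+b′ = trans (ℕP.+-suc e (suc d)) e+d+2≡1+b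
    1+d≤b : suc d ≤ b
    1+d≤b = ℕP.≤-pred (subst (suc (suc d) ≤_) e+d+2≡1+b′ (ℕP.m≤n+m (suc (suc d)) e))
    d≤b : d ≤ b
    d≤b = ℕP.≤-trans (ℕP.n≤1+n d) 1+d≤b

tailSum-zero-positive : ∀ b d → tailSum b 0 (suc d) ≡ 0
tailSum-zero-positive b d = begin
  tailSum b 0 (suc d)                         ≡⟨ sumFromTo-sumRange (suc d) b (S₂ 0) ⟩
  sumRange (S₂ 0) (suc d) (suc b ∸ suc d)     ≡⟨ sumRange-const (S₂ 0) (suc d) (b ∸ d) 0 (λ _ _ → refl) ⟩
  (b ∸ d) * 0                                 ≡⟨ ℕP.*-zeroʳ (b ∸ d) ⟩
  0                                           ∎
  where open ≡-Reasoning

tailSum-zero-zero : ∀ b → tailSum b 0 0 ≡ 1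
tailSum-zero-zero b = trans (tailSum-unfold b 0 0 z≤n) (cong suc (tailSum-zero-positive b 0))

increasing-identity : ∀ {b s} → (∀ m → m < b → s m < b) → IncreasingFrom b s 0 →
                      ∀ m → m < b → s m ≡ m
increasing-identity {b} {s} bounded inc m m<b =
  ℕP.≤-antisym (atMost (b ∸ suc m) m (ℕP.m∸n+n≡m m<b)) (atLeast m m<b)
  where
  atLeast : ∀ m → m < b → m ≤ s m
  atLeast zero    _     = z≤n
  atLeast (suc m) 1+m<b =
    ℕP.≤-<-trans (atLeast m (ℕP.<-trans (ℕP.n<1+n m) 1+m<b)) (increasingAt inc m z≤n 1+m<b)
  atMost : ∀ e m → e + suc m ≡ b → s m ≤ m
  atMost zero    m 1+m≡b = ℕP.≤-pred (subst (s m <_) (sym 1+m≡b) (bounded m (subst (m <_) 1+m≡b (ℕP.n<1+n m))))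
  atMost (suc e) m e+m+2≡b = ℕP.≤-pred (ℕP.<-≤-trans (increasingAt inc m z≤n 2+m≤b)
                                         (atMost e (suc m) e+m+2≡b′))
    where
    e+m+2≡b′ : e + suc (suc m) ≡ b
    e+m+2≡b′ = trans (ℕP.+-suc e (suc m)) e+m+2≡b
    2+m≤b : suc (suc m) ≤ b
    2+m≤b = subst (suc (suc m) ≤_) e+m+2≡b′ (ℕP.m≤n+m (suc (suc m)) e)

-- Base case n = 0: the empty word realises σ iff σ is the identity,
-- i.e. iff its increasing tail starts at 0.
JS-zero : ∀ {b} (σ : Permutation′ b) {c} → TailStart b (σℕ σ) c → JS σ 0 ≡ tailSum b 0 c
JS-zero {b} σ {c} tc = trans (JS-wordSum σ 0) (trans (ℕP.+-identityʳ _) (byStart c tc))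
  where
  bounded : ∀ m → m < b → σℕ σ m < b
  bounded m m<b = subst (_< b) (sym (σℕ-inRange σ m m<b)) (FinP.toℕ<n _)
  byStart : ∀ c → TailStart b (σℕ σ) c → indicator (realises? σ []) ≡ tailSum b 0 c
  byStart zero tc = trans (indicator-yes (realises? σ []) (λ j → FinP.toℕ-injective
    (trans (sym (increasing-identity bounded (increasing tc) (toℕ j) (FinP.toℕ<n j))) (σℕ-toℕ σ j))))
    (sym (tailSum-zero-zero b))
  byStart (suc d) tc = trans (indicator-no (realises? σ []) (λ identity → noAscentBefore tc d refl
    (subst₂ _<_ (sym (fixes identity d d<b)) (sym (fixes identity (suc d) (start<b tc))) (ℕP.n<1+n d))))
    (sym (tailSum-zero-positive b d))
    where
    d<b : d < b
    d<b = ℕP.<-trans (ℕP.n<1+n d) (start<b tc)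
    fixes : (∀ j → j ≡ σ ⟨$⟩ʳ j) → ∀ m → (m<b : m < b) → σℕ σ m ≡ m
    fixes identity m m<b = trans (σℕ-inRange σ m m<b) (trans (cong toℕ (sym (identity (fromℕ< m<b))))
                                                     (FinP.toℕ-fromℕ< m<b))

JS-tailSum : ∀ {k} n (σ : Permutation′ (suc k)) → JS σ n ≡ tailSum (suc k) n (start σ)
JS-tailSum zero    σ = JS-zero σ (tailStart-start σ (s≤s z≤n))
JS-tailSum {k} (suc n) σ = begin
  JS σ (suc n)                                      ≡⟨ JS-lastCard σ n ⟩
  ∑[ i < b ] JS (σ ∘ₚ card i) n                     ≡⟨ sum-cong-≗ (λ i → JS-tailSum n (σ ∘ₚ card i)) ⟩
  ∑[ i < b ] T n (start (σ ∘ₚ card i))              ≡⟨ ∑-permute (λ i → T n (start (σ ∘ₚ card i))) σ ⟩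
  ∑[ q < b ] T n (start (σ ∘ₚ card (σ ⟨$⟩ʳ q)))     ≡⟨ sum-cong-≗ (λ q → cong (T n) (start-afterCard σ q)) ⟩
  ∑[ q < b ] T n (newStart c (toℕ q))               ≡⟨ ∑-newStart (T n) c (ℕP.m∸n≤m b (L σ)) ⟩
  (c ∸ 1) * T n c + upperSum b n (c ∸ 1)            ≡⟨ tailSum-recurrence b n c (ℕP.m≤n⇒m≤1+n (ℕP.m∸n≤m b (L σ))) ⟨
  T (suc n) c                                       ∎
  where
  open ≡-Reasoning
  b = suc k
  T = tailSum b
  c = start σ

theorem2p3 : (b n : ℕ) → 1 ≤ b → 1 ≤ n → (σ : Permutation′ b) →
    JS σ n ≡ sumFromTo (b ∸ L σ) b (S₂ n)
theorem2p3 zero    n ()  _ σ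
theorem2p3 (suc k) n _   _ σ = JS-tailSum n σ
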